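{- For every $n\ge 3$, the grog numbers of the paths $P_n$ and $P_{n+1}$ satisfy $g(P_{n+1}) = g(P_n) + (n-1)$.
   Context: Grog algorithm: Let $G^\rightarrow$ be an orientation of a simple connected graph on $n\ge2$ vertices, labelled bijectively $v_1,\dots,v_n$, each vertex $v_i$ having initial population $\rho(v_i)=i$. A step consists of choosing a vertex $v_i$ and a number $\ell\ge 1$ of arcs $(v_i,v_j)$ still present in the current graph, with $\ell$ at most the current population of $v_i$, such that each chosen head $v_j$ has current population at least $1$; the chosen arcs are removed, the population of $v_i$ decreases by $\ell$, and the population of each chosen head decreases by $1$. Steps are repeated until no further step is possible. A predator-prey strategy $s_k$ is any such sequence of steps carried out until termination; its residual population $r_{s_k}(G^\rightarrow)$ is the sum of the final populations. The grog number of the labelled directed graph is $g(G^\rightarrow)=\min_{s_k} r_{s_k}(G^\rightarrow)$ over all strategies. The grog number $g(G)$ of a simple connected graph $G$ is the minimum of $g(G^\rightarrow)$ over all labellings of the vertices by $v_1,\dots,v_n$ and all orientations of the edges of $G$. -}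

module Defs where

open import Data.Nat using (ℕ; zero; suc; _+_; _∸_; _≤_)
open import Data.Bool using (Bool; true; false; if_then_else_; _∧_; not)
open import Data.Fin using (Fin; zero; suc; toℕ; inject₁; _≟_)
open import Data.Fin.Permutation using (Permutation′; _⟨$⟩ʳ_)
open import Data.Product using (Σ; _×_; _,_; ∃)
open import Relation.Nullary using (¬_)
open import Relation.Nullary.Decidable using (⌊_⌋)
open import Relation.Binary.PropositionalEquality using (_≡_)

sumF : ∀ {n} → (Fin n → ℕ) → ℕ
sumF {zero}  f = 0
sumF {suc n} f = f zero + sumF (λ i → f (suc i))

count : ∀ {m} → (Fin m → Bool) → ℕ
count S = sumF (λ k → if S k then 1 else 0)

record Graph : Set where
  field
    nV   : ℕ
    nE   : ℕ
    ends : Fin nE → Fin nV × Fin nV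
open Graph public

pathEnds : (n : ℕ) → Fin (n ∸ 1) → Fin n × Fin n
pathEnds zero    ()
pathEnds (suc k) i = inject₁ i , suc i

Path : ℕ → Graph
Path n = record { nV = n ; nE = n ∸ 1 ; ends = pathEnds n }

-- A labelled directed graph: vertices are identified with their labels
-- v_1..v_n, represented as Fin n (label i ↦ vertex v_{toℕ i + 1});
-- arcs indexed by Fin m, each arc = (tail , head).
Arcs : ℕ → ℕ → Set
Arcs n m = Fin m → Fin n × Fin n

tl : ∀ {n m} → Arcs n m → Fin m → Fin n
tl A k with A k
... | (u , _) = u

hd : ∀ {n m} → Arcs n m → Fin m → Fin n
hd A k with A k
... | (_ , v) = v

-- Orientation o and labelling π (position ↦ label) of a graph G give a
-- labelled directed graph.
orient : (G : Graph) → Permutation′ (nV G) → (Fin (nE G) → Bool) → Arcs (nV G) (nE G)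
orient G π o k with ends G k
... | (u , v) = if o k then (π ⟨$⟩ʳ u , π ⟨$⟩ʳ v) else (π ⟨$⟩ʳ v , π ⟨$⟩ʳ u)

record State (n m : ℕ) : Set where
  constructor st
  field
    pop     : Fin n → ℕ
    present : Fin m → Bool
open State public

initial : ∀ {n m} → State n m
initial = st (λ i → suc (toℕ i)) (λ _ → true)

Valid : ∀ {n m} → Arcs n m → Fin n → (Fin m → Bool) → State n m → Set
Valid A v S s =
  (∃ λ k → S k ≡ true) ×
  ((k : _) → S k ≡ true →
     (present s k ≡ true) × (tl A k ≡ v) × (1 ≤ pop s (hd A k))) ×
  (count S ≤ pop s v)

apply : ∀ {n m} → Arcs n m → Fin n → (Fin m → Bool) → State n m → State n m
apply A v S s =
  st (λ w → (pop s w ∸ (if ⌊ w ≟ v ⌋ then count S else 0))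
              ∸ count (λ k → S k ∧ ⌊ hd A k ≟ w ⌋))
     (λ k → present s k ∧ not (S k))

Terminal : ∀ {n m} → Arcs n m → State n m → Set
Terminal A s = ∀ v S → ¬ Valid A v S s

data Run {n m} (A : Arcs n m) : State n m → State n m → Set where
  done : ∀ {s} → Run A s s
  step : ∀ {s t} v S → Valid A v S s → Run A (apply A v S s) t → Run A s t

residual : ∀ {n m} → State n m → ℕ
residual s = sumF (pop s)

Achieves : ∀ {n m} → Arcs n m → ℕ → Set
Achieves A r = Σ _ λ t → Run A initial t × Terminal A t × residual t ≡ r

IsGrogDir : ∀ {n m} → Arcs n m → ℕ → Set
IsGrogDir A r = Achieves A r × (∀ r' → Achieves A r' → r ≤ r')

IsGrog : Graph → ℕ → Set
IsGrog G r =
  (Σ (Permutation′ (nV G)) λ π → Σ (Fin (nE G) → Bool) λ o → IsGrogDir (orient G π o) r) ×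
  (∀ π o r' → IsGrogDir (orient G π o) r' → r ≤ r')

-- A step removing ℓ arcs lowers the total population by at most 2ℓ, so the
-- potential "residual population + 2 · (arcs removed)" never decreases along a
-- strategy.  Starting from 1 + 2 + … + n, every strategy on any labelled
-- orientation of a graph with n vertices and m edges therefore leaves at least
-- n(n+1)/2 − 2m.  On the path, orienting every edge v_i → v_{i+1} and firing
-- the arcs one by one from v_1 onwards attains this bound, so
-- g(P_n) = n(n+1)/2 − 2(n−1), and consecutive values differ by n − 1.
module Submission where

open import Defs
open import Data.Nat using (ℕ; zero; suc; _+_; _*_; _∸_; _≤_; _<_; z≤n; s≤s)
open import Data.Product using (Σ; _×_; _,_; proj₁)

open import Algebra.Properties.CommutativeSemigroup using (interchange)
open import Data.Bool using (Bool; true; false; if_then_else_; _∧_; not)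
open import Data.Bool.Properties using (∧-zeroʳ)
open import Data.Empty using (⊥-elim)
open import Data.Fin using (Fin; zero; suc; toℕ; inject₁; fromℕ; fromℕ<; _≟_)
open import Data.Fin.Permutation using () renaming (id to idPerm)
open import Data.Fin.Properties
  using (toℕ-inject₁; toℕ-fromℕ; toℕ-fromℕ<; toℕ-injective; toℕ<n; <⇒≢)
open import Data.Nat.Properties
  using ( module ≤-Reasoning; ≤-refl; ≤-reflexive; ≤-trans; <-trans; <⇒≤; n<1+n
        ; m≤n⇒m≤1+n; m≤n⇒m<n∨m≡n; +-assoc; +-comm; +-identityʳ; +-suc; *-suc
        ; +-commutativeSemigroup; +-mono-≤; +-monoˡ-≤; *-monoʳ-≤; +-cancelʳ-≤
        ; +-cancelʳ-≡; m≤n+m; m≤n+m∸n; m∸n+n≡m; ∸-+-assoc )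
open import Data.Nat.Tactic.RingSolver using (solve-∀)
open import Data.Sum using (inj₁; inj₂)
open import Function using (_∘_)
open import Relation.Binary.PropositionalEquality
open import Relation.Nullary using (yes; no)
open import Relation.Nullary.Decidable using (⌊_⌋; isYes≗does; dec-true; dec-false)

ind : Bool → ℕ
ind b = if b then 1 else 0

≟-refl : ∀ {n} (a : Fin n) → ⌊ a ≟ a ⌋ ≡ true
≟-refl a = trans (isYes≗does (a ≟ a)) (dec-true (a ≟ a) refl)

≟-≢ : ∀ {n} {a b : Fin n} → a ≢ b → ⌊ a ≟ b ⌋ ≡ false
≟-≢ {a = a} {b} a≢b = trans (isYes≗does (a ≟ b)) (dec-false (a ≟ b) a≢b)

≟-≡ : ∀ {n} {a b : Fin n} → ⌊ a ≟ b ⌋ ≡ true → a ≡ b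
≟-≡ {a = a} {b} eq with a ≟ b
... | yes a≡b = a≡b

≟-sym : ∀ {n} (a b : Fin n) → ⌊ a ≟ b ⌋ ≡ ⌊ b ≟ a ⌋
≟-sym a b with a ≟ b | b ≟ a
... | yes _   | yes _   = refl
... | no _    | no _    = refl
... | yes a≡b | no b≢a  = ⊥-elim (b≢a (sym a≡b))
... | no a≢b  | yes b≡a = ⊥-elim (a≢b (sym b≡a))

≟-suc : ∀ {n} (a b : Fin n) → ⌊ _≟_ {suc n} (suc a) (suc b) ⌋ ≡ ⌊ a ≟ b ⌋
≟-suc a b = trans (isYes≗does (suc a ≟ suc b)) (sym (isYes≗does (a ≟ b)))

sumF-cong : ∀ {n} {f g : Fin n → ℕ} → (∀ i → f i ≡ g i) → sumF f ≡ sumF g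
sumF-cong {zero}  f≗g = refl
sumF-cong {suc n} f≗g = cong₂ _+_ (f≗g zero) (sumF-cong (f≗g ∘ suc))

sumF-mono : ∀ {n} {f g : Fin n → ℕ} → (∀ i → f i ≤ g i) → sumF f ≤ sumF g
sumF-mono {zero}  f≤g = z≤n
sumF-mono {suc n} f≤g = +-mono-≤ (f≤g zero) (sumF-mono (f≤g ∘ suc))

sumF-+ : ∀ {n} (f g : Fin n → ℕ) → sumF (λ i → f i + g i) ≡ sumF f + sumF g
sumF-+ {zero}  f g = refl
sumF-+ {suc n} f g = trans (cong (f zero + g zero +_) (sumF-+ (f ∘ suc) (g ∘ suc)))
                           (interchange +-commutativeSemigroup (f zero) (g zero) _ _)

sumF-zero : ∀ n → sumF {n} (λ _ → 0) ≡ 0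
sumF-zero zero    = refl
sumF-zero (suc n) = sumF-zero n

sumF-swap : ∀ {n m} (f : Fin n → Fin m → ℕ) →
            sumF (λ i → sumF (f i)) ≡ sumF (λ j → sumF (λ i → f i j))
sumF-swap {zero}  {m} f = sym (sumF-zero m)
sumF-swap {suc n}     f = trans (cong (sumF (f zero) +_) (sumF-swap (f ∘ suc)))
                                (sym (sumF-+ (f zero) _))

sumF-last : ∀ n (f : Fin (suc n) → ℕ) → sumF f ≡ sumF (f ∘ inject₁) + f (fromℕ n)
sumF-last zero    f = +-comm (f zero) 0
sumF-last (suc n) f = trans (cong (f zero +_) (sumF-last n (f ∘ suc)))
                            (sym (+-assoc (f zero) _ _))

sumF-point : ∀ {n} (v : Fin n) c → sumF (λ w → if ⌊ w ≟ v ⌋ then c else 0) ≡ c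
sumF-point {suc n} zero    c = trans (cong (c +_) (sumF-zero n)) (+-identityʳ c)
sumF-point {suc n} (suc v) c =
  trans (sumF-cong (λ w → cong (if_then c else 0) (≟-suc w v))) (sumF-point v c)

sumF-∸-point : ∀ {n} (p : Fin n → ℕ) (u : Fin n) → 1 ≤ p u →
               sumF (λ w → p w ∸ ind ⌊ w ≟ u ⌋) + 1 ≡ sumF p
sumF-∸-point {n} p u 1≤pu = begin
  sumF (λ w → p w ∸ ind ⌊ w ≟ u ⌋) + 1
    ≡⟨ cong (sumF (λ w → p w ∸ ind ⌊ w ≟ u ⌋) +_) (sym (sumF-point u 1)) ⟩
  sumF (λ w → p w ∸ ind ⌊ w ≟ u ⌋) + sumF (λ w → ind ⌊ w ≟ u ⌋)
    ≡⟨ sym (sumF-+ {n} _ _) ⟩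
  sumF (λ w → p w ∸ ind ⌊ w ≟ u ⌋ + ind ⌊ w ≟ u ⌋)
    ≡⟨ sumF-cong (λ w → m∸n+n≡m (ind≤p w)) ⟩
  sumF p ∎
  where
  open ≡-Reasoning
  ind≤p : ∀ w → ind ⌊ w ≟ u ⌋ ≤ p w
  ind≤p w with w ≟ u
  ... | yes refl = 1≤pu
  ... | no _     = z≤n

count-≤ : ∀ {m} (S : Fin m → Bool) → count S ≤ m
count-≤ {zero}  S = z≤n
count-≤ {suc m} S with S zero
... | true  = s≤s (count-≤ (S ∘ suc))
... | false = m≤n⇒m≤1+n (count-≤ (S ∘ suc))

triangular : ℕ → ℕ
triangular n = sumF {n} (λ i → suc (toℕ i))

triangular-suc : ∀ n → triangular (suc n) ≡ triangular n + suc n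
triangular-suc n =
  trans (sumF-last n (λ i → suc (toℕ i)))
        (cong₂ _+_ (sumF-cong {n} (λ i → cong suc (toℕ-inject₁ i))) (cong suc (toℕ-fromℕ n)))

removed : ∀ {n m} → State n m → ℕ
removed s = count (not ∘ present s)

potential : ∀ {n m} → State n m → ℕ
potential s = residual s + 2 * removed s

module _ {n m : ℕ} (A : Arcs n m) where

  residual-apply : ∀ v S s → residual s ≤ 2 * count S + residual (apply A v S s)
  residual-apply v S s = begin
    residual s
      ≤⟨ sumF-mono split ⟩
    sumF (λ w → (tailLoss w + headLoss w) + pop s′ w)
      ≡⟨ sumF-+ {n} _ (pop s′) ⟩
    sumF (λ w → tailLoss w + headLoss w) + residual s′
      ≡⟨ cong (_+ residual s′) (trans (sumF-+ tailLoss headLoss)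
                                      (cong₂ _+_ (sumF-point v (count S)) heads)) ⟩
    count S + count S + residual s′
      ≡⟨ cong (λ x → count S + x + residual s′) (sym (+-identityʳ (count S))) ⟩
    2 * count S + residual s′ ∎
    where
    open ≤-Reasoning
    s′ = apply A v S s
    tailLoss headLoss : Fin n → ℕ
    tailLoss w = if ⌊ w ≟ v ⌋ then count S else 0
    headLoss w = count (λ k → S k ∧ ⌊ hd A k ≟ w ⌋)
    split : ∀ w → pop s w ≤ (tailLoss w + headLoss w) + pop s′ w
    split w = ≤-trans (m≤n+m∸n (pop s w) (tailLoss w + headLoss w))
                      (≤-reflexive (cong (tailLoss w + headLoss w +_)
                                         (sym (∸-+-assoc (pop s w) (tailLoss w) (headLoss w)))))
    headsOf : ∀ k → sumF (λ w → ind (S k ∧ ⌊ hd A k ≟ w ⌋)) ≡ ind (S k)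
    headsOf k with S k
    ... | true  = trans (sumF-cong {n} (λ w → cong ind (≟-sym (hd A k) w))) (sumF-point (hd A k) 1)
    ... | false = sumF-zero n
    heads : sumF headLoss ≡ count S
    heads = trans (sumF-swap (λ w k → ind (S k ∧ ⌊ hd A k ≟ w ⌋))) (sumF-cong headsOf)

  removed-apply : ∀ {v S s} → Valid A v S s → removed (apply A v S s) ≡ count S + removed s
  removed-apply {S = S} {s} (_ , chosen , _) = trans (sumF-cong newlyRemoved) (sumF-+ {m} _ _)
    where
    newlyRemoved : ∀ k → ind (not (present s k ∧ not (S k))) ≡ ind (S k) + ind (not (present s k))
    newlyRemoved k with S k in Sk
    ... | true rewrite proj₁ (chosen k Sk) = refl
    ... | false with present s k
    ...   | true  = refl
    ...   | false = refl

  potential-apply : ∀ {v S s} → Valid A v S s → potential s ≤ potential (apply A v S s)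
  potential-apply {v} {S} {s} valid = begin
    residual s + 2 * removed s
      ≤⟨ +-monoˡ-≤ (2 * removed s) (residual-apply v S s) ⟩
    2 * count S + residual s′ + 2 * removed s
      ≡⟨ regroup (count S) (residual s′) (removed s) ⟩
    residual s′ + 2 * (count S + removed s)
      ≡⟨ cong (λ x → residual s′ + 2 * x) (sym (removed-apply valid)) ⟩
    potential s′ ∎
    where
    open ≤-Reasoning
    s′ = apply A v S s
    regroup : ∀ c r d → 2 * c + r + 2 * d ≡ r + 2 * (c + d)
    regroup = solve-∀

  potential-run : ∀ {s t} → Run A s t → potential s ≤ potential t
  potential-run done                 = ≤-refl
  potential-run (step _ _ valid run) = ≤-trans (potential-apply valid) (potential-run run)

  triangular-≤-achieved : ∀ {r} → Achieves A r → triangular n ≤ r + 2 * m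
  triangular-≤-achieved {r} (t , run , _ , residual≡r) = begin
    triangular n
      ≡⟨ sym (+-identityʳ (triangular n)) ⟩
    triangular n + 2 * 0
      ≡⟨ cong (λ x → triangular n + 2 * x) (sym (sumF-zero m)) ⟩
    potential {n} {m} initial
      ≤⟨ potential-run run ⟩
    residual t + 2 * removed t
      ≤⟨ +-mono-≤ (≤-reflexive residual≡r) (*-monoʳ-≤ 2 (count-≤ (not ∘ present t))) ⟩
    r + 2 * m ∎
    where open ≤-Reasoning

achieves-tight⇒isGrog : ∀ G π o {r} → Achieves (orient G π o) r →
                        r + 2 * nE G ≡ triangular (nV G) → IsGrog G r
achieves-tight⇒isGrog G π o {r} achieves tight =
  (π , o , achieves , λ _ → below) , λ _ _ _ isGrog′ → below (proj₁ isGrog′)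
  where
  below : ∀ {A r′} → Achieves A r′ → r ≤ r′
  below {A} {r′} achieves′ =
    +-cancelʳ-≤ (2 * nE G) r r′
      (subst (_≤ r′ + 2 * nE G) (sym tight) (triangular-≤-achieved A achieves′))

only : ∀ {m} → Fin m → Fin m → Bool
only k k′ = ⌊ k′ ≟ k ⌋

count-only : ∀ {m} (k : Fin m) → count (only k) ≡ 1
count-only k = sumF-point k 1

module _ {n m : ℕ} (A : Arcs n m) where

  fire : Fin m → State n m → State n m
  fire k = apply A (tl A k) (only k)

  fire-valid : ∀ {k s} → present s k ≡ true → 1 ≤ pop s (tl A k) → 1 ≤ pop s (hd A k) →
               Valid A (tl A k) (only k) s
  fire-valid {k} {s} present-k 1≤tail 1≤head =
    (k , ≟-refl k) , chosen , subst (_≤ pop s (tl A k)) (sym (count-only k)) 1≤tail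
    where
    chosen : ∀ k′ → only k k′ ≡ true →
             (present s k′ ≡ true) × (tl A k′ ≡ tl A k) × (1 ≤ pop s (hd A k′))
    chosen k′ k′≟k with ≟-≡ k′≟k
    ... | refl = present-k , refl , 1≤head

  pop-fire : ∀ k s w → pop (fire k s) w ≡ pop s w ∸ ind ⌊ w ≟ tl A k ⌋ ∸ ind ⌊ w ≟ hd A k ⌋
  pop-fire k s w = cong₂ _∸_ (cong (pop s w ∸_) (tailLoss ⌊ w ≟ tl A k ⌋)) headLoss
    where
    tailLoss : ∀ b → (if b then count (only k) else 0) ≡ ind b
    tailLoss true  = count-only k
    tailLoss false = refl
    headLoss : count (λ k′ → only k k′ ∧ ⌊ hd A k′ ≟ w ⌋) ≡ ind ⌊ w ≟ hd A k ⌋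
    headLoss = begin
      count (λ k′ → only k k′ ∧ ⌊ hd A k′ ≟ w ⌋)
        ≡⟨ sumF-cong {m} onlyAt ⟩
      sumF (λ k′ → if ⌊ k′ ≟ k ⌋ then ind ⌊ hd A k ≟ w ⌋ else 0)
        ≡⟨ sumF-point k _ ⟩
      ind ⌊ hd A k ≟ w ⌋
        ≡⟨ cong ind (≟-sym (hd A k) w) ⟩
      ind ⌊ w ≟ hd A k ⌋ ∎
      where
      open ≡-Reasoning
      onlyAt : ∀ k′ → ind (only k k′ ∧ ⌊ hd A k′ ≟ w ⌋) ≡
                      (if ⌊ k′ ≟ k ⌋ then ind ⌊ hd A k ≟ w ⌋ else 0)
      onlyAt k′ with k′ ≟ k
      ... | yes refl = refl
      ... | no _     = refl

  residual-fire : ∀ {k s} → tl A k ≢ hd A k → 1 ≤ pop s (tl A k) → 1 ≤ pop s (hd A k) →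
                  residual (fire k s) + 2 ≡ residual s
  residual-fire {k} {s} tail≢head 1≤tail 1≤head = begin
    residual (fire k s) + 2
      ≡⟨ cong (_+ 2) (sumF-cong {n} (pop-fire k s)) ⟩
    sumF (λ w → afterTail w ∸ ind ⌊ w ≟ hd A k ⌋) + 2
      ≡⟨ sym (+-assoc _ 1 1) ⟩
    sumF (λ w → afterTail w ∸ ind ⌊ w ≟ hd A k ⌋) + 1 + 1
      ≡⟨ cong (_+ 1) (sumF-∸-point afterTail (hd A k) 1≤afterTail) ⟩
    sumF afterTail + 1
      ≡⟨ sumF-∸-point (pop s) (tl A k) 1≤tail ⟩
    residual s ∎
    where
    open ≡-Reasoning
    afterTail : Fin n → ℕ
    afterTail w = pop s w ∸ ind ⌊ w ≟ tl A k ⌋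
    1≤afterTail : 1 ≤ afterTail (hd A k)
    1≤afterTail rewrite ≟-≢ (tail≢head ∘ sym) = 1≤head

module ForwardPath (m : ℕ) where

  -- Arc k runs from vertex k to vertex k + 1: tl A k = inject₁ k and
  -- hd A k = suc k hold by computation.
  A : Arcs (suc m) m
  A = orient (Path (suc m)) idPerm (λ _ → true)

  record Swept (j : ℕ) (s : State (suc m) m) : Set where
    field
      fired          : ∀ k → toℕ k < j → present s k ≡ false
      unfired        : ∀ k → j ≤ toℕ k → present s k ≡ true
      frontier       : ∀ w → toℕ w ≡ j → 1 ≤ pop s w
      untouched      : ∀ w → j < toℕ w → pop s w ≡ suc (toℕ w)
      swept-residual : residual s + 2 * j ≡ triangular (suc m)
  open Swept

  swept-initial : Swept 0 initial
  swept-initial = record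
    { fired          = λ _ ()
    ; unfired        = λ _ _ → refl
    ; frontier       = λ _ _ → s≤s z≤n
    ; untouched      = λ _ _ → refl
    ; swept-residual = +-identityʳ _
    }

  swept-fire : ∀ {j s} k → toℕ k ≡ j → Swept j s →
               Valid A (inject₁ k) (only k) s × Swept (suc j) (fire A k s)
  swept-fire {s = s} k refl swept =
    fire-valid A {k} {s} (unfired swept k ≤-refl) 1≤tail 1≤head , record
    { fired          = fired′
    ; unfired        = unfired′
    ; frontier       = frontier′
    ; untouched      = untouched′
    ; swept-residual = residual′
    }
    where
    tail<head : toℕ (inject₁ k) < toℕ (suc k)
    tail<head = s≤s (≤-reflexive (toℕ-inject₁ k))
    1≤tail : 1 ≤ pop s (inject₁ k)
    1≤tail = frontier swept (inject₁ k) (toℕ-inject₁ k)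
    head-pop : pop s (suc k) ≡ suc (suc (toℕ k))
    head-pop = untouched swept (suc k) ≤-refl
    1≤head : 1 ≤ pop s (suc k)
    1≤head = subst (1 ≤_) (sym head-pop) (s≤s z≤n)
    fired′ : ∀ k′ → toℕ k′ < suc (toℕ k) → present (fire A k s) k′ ≡ false
    fired′ k′ (s≤s k′≤k) with m≤n⇒m<n∨m≡n k′≤k
    ... | inj₁ k′<k rewrite fired swept k′ k′<k = refl
    ... | inj₂ k′≡k rewrite toℕ-injective k′≡k | ≟-refl k = ∧-zeroʳ (present s k)
    unfired′ : ∀ k′ → suc (toℕ k) ≤ toℕ k′ → present (fire A k s) k′ ≡ true
    unfired′ k′ k<k′ rewrite unfired swept k′ (<⇒≤ k<k′) | ≟-≢ (<⇒≢ k<k′ ∘ sym) = refl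
    frontier′ : ∀ w → toℕ w ≡ suc (toℕ k) → 1 ≤ pop (fire A k s) w
    frontier′ w w≡head rewrite toℕ-injective {i = w} {j = suc k} w≡head
                             | pop-fire A k s (suc k)
                             | ≟-≢ (<⇒≢ tail<head ∘ sym) | ≟-refl (suc k) | head-pop = s≤s z≤n
    untouched′ : ∀ w → suc (toℕ k) < toℕ w → pop (fire A k s) w ≡ suc (toℕ w)
    untouched′ w head<w
      rewrite pop-fire A k s w
            | ≟-≢ (<⇒≢ (<-trans tail<head head<w) ∘ sym) | ≟-≢ (<⇒≢ head<w ∘ sym)
      = untouched swept w (<-trans (n<1+n _) head<w)
    residual′ : residual (fire A k s) + 2 * suc (toℕ k) ≡ triangular (suc m)
    residual′ = begin
      residual (fire A k s) + 2 * suc (toℕ k)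
        ≡⟨ cong (residual (fire A k s) +_) (*-suc 2 (toℕ k)) ⟩
      residual (fire A k s) + (2 + 2 * toℕ k)
        ≡⟨ sym (+-assoc (residual (fire A k s)) 2 (2 * toℕ k)) ⟩
      residual (fire A k s) + 2 + 2 * toℕ k
        ≡⟨ cong (_+ 2 * toℕ k) (residual-fire A {k} {s} (<⇒≢ tail<head) 1≤tail 1≤head) ⟩
      residual s + 2 * toℕ k
        ≡⟨ swept-residual swept ⟩
      triangular (suc m) ∎
      where open ≡-Reasoning

  sweep : ∀ d {j s} → d + j ≡ m → Swept j s → Σ _ λ t → Run A s t × Swept m t
  sweep zero    refl swept = _ , done , swept
  sweep (suc d) {j} d+j≡m swept =
    let valid , swept′ = swept-fire k toℕ-k swept
        t , run , swept-t = sweep d (trans (+-suc d j) d+j≡m) swept′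
    in  t , step _ _ valid run , swept-t
    where
    j<m : j < m
    j<m = subst (j <_) d+j≡m (s≤s (m≤n+m j d))
    k : Fin m
    k = fromℕ< j<m
    toℕ-k : toℕ k ≡ j
    toℕ-k = toℕ-fromℕ< j<m

  swept-terminal : ∀ {t} → Swept m t → Terminal A t
  swept-terminal swept _ _ ((k , chosen-k) , chosen , _)
    with () ← trans (sym (proj₁ (chosen k chosen-k))) (fired swept k (toℕ<n k))

path-isGrog : ∀ m → Σ ℕ λ r → IsGrog (Path (suc m)) r × r + 2 * m ≡ triangular (suc m)
path-isGrog m =
  let t , run , swept = sweep m (+-identityʳ m) swept-initial
  in  residual t ,
      achieves-tight⇒isGrog (Path (suc m)) idPerm (λ _ → true)
        (t , run , swept-terminal swept , refl) (Swept.swept-residual swept) ,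
      Swept.swept-residual swept
  where open ForwardPath m

tight-difference : ∀ m {r r′} → r + 2 * m ≡ triangular (suc m) →
                   r′ + 2 * suc m ≡ triangular (suc (suc m)) → r′ ≡ r + m
tight-difference m {r} {r′} tight tight′ = +-cancelʳ-≡ (2 * suc m) r′ (r + m) (begin
  r′ + 2 * suc m                   ≡⟨ tight′ ⟩
  triangular (suc (suc m))         ≡⟨ triangular-suc (suc m) ⟩
  triangular (suc m) + suc (suc m) ≡⟨ cong (_+ suc (suc m)) (sym tight) ⟩
  r + 2 * m + suc (suc m)          ≡⟨ regroup r m ⟩
  r + m + 2 * suc m                ∎)
  where
  open ≡-Reasoning
  regroup : ∀ r m → r + 2 * m + suc (suc m) ≡ r + m + 2 * suc m
  regroup = solve-∀

corollary2p5 : (n : ℕ) → 3 ≤ n →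
    Σ ℕ λ g → IsGrog (Path n) g × IsGrog (Path (suc n)) (g + (n ∸ 1))
corollary2p5 (suc m) _ =
  let r  , isGrog-r  , tight  = path-isGrog m
      r′ , isGrog-r′ , tight′ = path-isGrog (suc m)
  in  r , isGrog-r ,
      subst (IsGrog (Path (suc (suc m)))) (tight-difference m tight tight′) isGrog-r′
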